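{- Let $\Gamma$ be a non-complete edge-regular graph on $v>0$ vertices with valency $k\ge1$, in which any two adjacent vertices have exactly $\lambda$ common neighbours. Then $v+\lambda-2k\ge0$, with equality if and only if $\Gamma$ is a complete multipartite graph.
   Context: A graph is edge-regular if it is regular and any two adjacent vertices have the same number of common neighbours. -}

module Defs where

open import Data.Nat using (ℕ; zero; suc; _+_)
open import Data.Fin using (Fin; zero; suc)
open import Data.Bool using (Bool; true; false; if_then_else_; _∧_)
open import Data.Product using (Σ; ∃; _×_; _,_)
open import Relation.Binary.PropositionalEquality using (_≡_; _≢_)
open import Function.Bundles using (_⇔_)

count : ∀ {n} → (Fin n → Bool) → ℕ
count {zero}  P = 0
count {suc n} P = (if P zero then 1 else 0) + count (λ i → P (suc i))

record Graph (v : ℕ) : Set where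
  field
    adj    : Fin v → Fin v → Bool
    sym    : ∀ x y → adj x y ≡ adj y x
    irrefl : ∀ x → adj x x ≡ false
open Graph public

deg : ∀ {v} → Graph v → Fin v → ℕ
deg G x = count (λ z → adj G x z)

common : ∀ {v} → Graph v → Fin v → Fin v → ℕ
common G x y = count (λ z → adj G x z ∧ adj G y z)

Regular : ∀ {v} → Graph v → ℕ → Set
Regular G k = ∀ x → deg G x ≡ k

EdgeRegular : ∀ {v} → Graph v → ℕ → ℕ → Set
EdgeRegular G k l = Regular G k × (∀ x y → adj G x y ≡ true → common G x y ≡ l)

Complete : ∀ {v} → Graph v → Set
Complete G = ∀ x y → x ≢ y → adj G x y ≡ true

CompleteMultipartite : ∀ {v} → Graph v → Set
CompleteMultipartite {v} G =
  Σ ℕ λ m → Σ (Fin v → Fin m) λ part →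
    ∀ x y → (adj G x y ≡ true) ⇔ (part x ≢ part y)

-- For an edge xy, inclusion–exclusion gives 2k = deg x + deg y = |N(x) ∪ N(y)| + λ ≤ v + λ,
-- with equality exactly when every edge xy dominates the graph (each vertex is adjacent
-- to x or to y). That in turn says non-adjacency is transitive, i.e. an equivalence
-- relation whose classes are the parts of a complete multipartite graph; conversely, in
-- a complete multipartite graph a vertex adjacent to neither end of an edge would lie in
-- both of their (distinct) parts.
module Submission where

open import Defs hiding (sym)
open import Data.Nat using (ℕ; zero; suc; pred; _+_; _*_; _≤_; _>_; _≥_; z≤n; s≤s)
open import Data.Nat.Properties
  using (+-suc; +-identityʳ; +-cancelʳ-≡; +-monoˡ-≤; ≤-trans; n≤1+n; 1+n≰n)
open import Data.Fin using (Fin; zero; suc; inject₁)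
open import Data.Fin.Properties using (inject₁-injective) renaming (_≟_ to _≟ᶠ_)
open import Data.Bool using (Bool; true; false; _∨_; _∧_; if_then_else_)
open import Data.Product using (_×_; _,_; ∃; proj₁; proj₂)
open import Data.Empty using (⊥-elim)
open import Relation.Nullary using (¬_; yes; no)
open import Relation.Binary.PropositionalEquality
  using (_≡_; _≢_; refl; sym; trans; cong; cong₂; subst; module ≡-Reasoning)
open import Function.Bundles using (_⇔_; mk⇔; Equivalence)

count-∨+count-∧ : ∀ {n} (f g : Fin n → Bool) →
                  count f + count g ≡ count (λ z → f z ∨ g z) + count (λ z → f z ∧ g z)
count-∨+count-∧ {zero}  f g = refl
count-∨+count-∧ {suc n} f g
  with f zero | g zero | count-∨+count-∧ (λ i → f (suc i)) (λ i → g (suc i))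
... | true  | true  | ih = cong suc (trans (+-suc _ _) (trans (cong suc ih) (sym (+-suc _ _))))
... | true  | false | ih = cong suc ih
... | false | true  | ih = trans (+-suc _ _) (cong suc ih)
... | false | false | ih = ih

count≤n : ∀ {n} (f : Fin n → Bool) → count f ≤ n
count≤n {zero}  f = z≤n
count≤n {suc n} f with f zero
... | true  = s≤s (count≤n (λ i → f (suc i)))
... | false = ≤-trans (count≤n (λ i → f (suc i))) (n≤1+n n)

count≡n⇒all : ∀ {n} (f : Fin n → Bool) → count f ≡ n → ∀ z → f z ≡ true
count≡n⇒all {suc n} f eq z with f zero in f0
count≡n⇒all {suc n} f eq zero    | true  = f0
count≡n⇒all {suc n} f eq (suc z) | true  = count≡n⇒all (λ i → f (suc i)) (cong pred eq) z
count≡n⇒all {suc n} f eq z       | false =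
  ⊥-elim (1+n≰n (subst (_≤ n) eq (count≤n (λ i → f (suc i)))))

all⇒count≡n : ∀ {n} (f : Fin n → Bool) → (∀ z → f z ≡ true) → count f ≡ n
all⇒count≡n {zero}  f all = refl
all⇒count≡n {suc n} f all rewrite all zero =
  cong suc (all⇒count≡n (λ i → f (suc i)) (λ i → all (suc i)))

count≥1⇒∃ : ∀ {n} (f : Fin n → Bool) → count f ≥ 1 → ∃ λ z → f z ≡ true
count≥1⇒∃ {suc n} f c≥1 with f zero in f0
... | true  = zero , f0
... | false with count≥1⇒∃ (λ i → f (suc i)) c≥1
...   | z , fz = suc z , fz

firstFalse : ∀ {n} → (Fin n → Bool) → Fin (suc n)
firstFalse {zero}  f = zero
firstFalse {suc n} f = if f zero then suc (firstFalse (λ i → f (suc i))) else zero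

firstFalse-cong : ∀ {n} (f g : Fin n → Bool) → (∀ z → f z ≡ g z) → firstFalse f ≡ firstFalse g
firstFalse-cong {zero}  f g f≗g = refl
firstFalse-cong {suc n} f g f≗g rewrite f≗g zero with g zero
... | true  = cong suc (firstFalse-cong (λ i → f (suc i)) (λ i → g (suc i)) (λ i → f≗g (suc i)))
... | false = refl

firstFalse-false : ∀ {n} (f : Fin n → Bool) x → f x ≡ false →
                   ∃ λ z → firstFalse f ≡ inject₁ z × f z ≡ false
firstFalse-false {suc n} f x fx with f zero in f0
... | false = zero , refl , f0
firstFalse-false {suc n} f zero    fx | true with () ← trans (sym f0) fx
firstFalse-false {suc n} f (suc x) fx | true with firstFalse-false (λ i → f (suc i)) x fx
... | z , first≡z , fz = suc z , cong suc first≡z , fz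

module _ {v : ℕ} (G : Graph v) where

  ∣N∪N∣ : Fin v → Fin v → ℕ
  ∣N∪N∣ x y = count (λ z → adj G x z ∨ adj G y z)

  Dominates : Fin v → Fin v → Set
  Dominates x y = ∀ z → adj G x z ∨ adj G y z ≡ true

  EdgesDominate : Set
  EdgesDominate = ∀ x y → adj G x y ≡ true → Dominates x y

  NonAdjacencyTransitive : Set
  NonAdjacencyTransitive = ∀ x y z → adj G x y ≡ false → adj G y z ≡ false → adj G x z ≡ false

  deg+deg≡∣N∪N∣+common : ∀ x y → deg G x + deg G y ≡ ∣N∪N∣ x y + common G x y
  deg+deg≡∣N∪N∣+common x y = count-∨+count-∧ (adj G x) (adj G y)

  edgesDominate⇒nonAdjacencyTransitive : EdgesDominate → NonAdjacencyTransitive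
  edgesDominate⇒nonAdjacencyTransitive dom x y z xy yz with adj G x z in xz
  ... | false = refl
  ... | true  -- y would be adjacent to neither end of the edge xz
    with adj G x y | adj G z y | dom x z xz y | xy | trans (Graph.sym G z y) yz
  ... | false | false | () | _ | _

  nonAdjacencyTransitive⇒completeMultipartite : NonAdjacencyTransitive → CompleteMultipartite G
  nonAdjacencyTransitive⇒completeMultipartite trans≁ =
    suc v , part , λ x y → mk⇔ (adjacent⇒parts≢ x y) (parts≢⇒adjacent x y)
    where
    part : Fin v → Fin (suc v)
    part x = firstFalse (adj G x)

    adjacent⇒parts≢ : ∀ x y → adj G x y ≡ true → part x ≢ part y
    adjacent⇒parts≢ x y xy same
      with firstFalse-false (adj G x) x (irrefl G x) | firstFalse-false (adj G y) y (irrefl G y)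
    ... | z , px≡z , xz | w , py≡w , yw with inject₁-injective (trans (sym px≡z) (trans same py≡w))
    ... | refl with () ← trans (sym xy) (trans≁ x z y xz (trans (Graph.sym G z y) yw))

    parts≢⇒adjacent : ∀ x y → part x ≢ part y → adj G x y ≡ true
    parts≢⇒adjacent x y parts≢ with adj G x y in xy
    ... | true  = refl
    ... | false = ⊥-elim (parts≢ (firstFalse-cong (adj G x) (adj G y) sameNeighbours))
      where
      sameNeighbours : ∀ z → adj G x z ≡ adj G y z
      sameNeighbours z with adj G x z in xz | adj G y z in yz
      ... | true  | true  = refl
      ... | false | false = refl
      ... | true  | false with () ← trans (sym xz) (trans≁ x y z xy yz)
      ... | false | true  with () ← trans (sym yz) (trans≁ y x z (trans (Graph.sym G y x) xy) xz)

  completeMultipartite⇒edgesDominate : CompleteMultipartite G → EdgesDominate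
  completeMultipartite⇒edgesDominate (m , part , adj⇔parts≢) x y xy z
    with adj G x z in xz | adj G y z in yz
  ... | true  | _     = refl
  ... | false | true  = refl
  ... | false | false = ⊥-elim (Equivalence.to (adj⇔parts≢ x y) xy
                                  (trans (samePart x xz) (sym (samePart y yz))))
    where
    samePart : ∀ u → adj G u z ≡ false → part u ≡ part z
    samePart u uz with part u ≟ᶠ part z
    ... | yes same = same
    ... | no  parts≢ with () ← trans (sym (Equivalence.from (adj⇔parts≢ u z) parts≢)) uz

module _ {v k l : ℕ} (G : Graph v) (edgeRegular : EdgeRegular G k l) where

  private
    regular : Regular G k
    regular = proj₁ edgeRegular

    λ-common : ∀ x y → adj G x y ≡ true → common G x y ≡ l
    λ-common = proj₂ edgeRegular

  2k≡∣N∪N∣+λ : ∀ {x y} → adj G x y ≡ true → 2 * k ≡ ∣N∪N∣ G x y + l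
  2k≡∣N∪N∣+λ {x} {y} xy = begin
    2 * k                         ≡⟨ cong (k +_) (+-identityʳ k) ⟩
    k + k                         ≡⟨ sym (cong₂ _+_ (regular x) (regular y)) ⟩
    deg G x + deg G y             ≡⟨ deg+deg≡∣N∪N∣+common G x y ⟩
    ∣N∪N∣ G x y + common G x y    ≡⟨ cong (∣N∪N∣ G x y +_) (λ-common x y xy) ⟩
    ∣N∪N∣ G x y + l               ∎
    where open ≡-Reasoning

  2k≤v+λ : ∀ {x y} → adj G x y ≡ true → 2 * k ≤ v + l
  2k≤v+λ xy = subst (_≤ v + l) (sym (2k≡∣N∪N∣+λ xy)) (+-monoˡ-≤ l (count≤n _))

  v+λ≡2k⇔dominates : ∀ {x y} → adj G x y ≡ true → (v + l ≡ 2 * k) ⇔ Dominates G x y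
  v+λ≡2k⇔dominates xy = mk⇔
    (λ eq → count≡n⇒all _ (+-cancelʳ-≡ _ _ _ (trans (sym (2k≡∣N∪N∣+λ xy)) (sym eq))))
    (λ dom → trans (cong (_+ l) (sym (all⇒count≡n _ dom))) (sym (2k≡∣N∪N∣+λ xy)))

lemma2p2 : (v k l : ℕ) → (G : Graph v) → v > 0 → k ≥ 1 →
           EdgeRegular G k l → ¬ Complete G →
           (2 * k ≤ v + l) × ((v + l ≡ 2 * k) ⇔ CompleteMultipartite G)
lemma2p2 zero    k l G () _ _ _
lemma2p2 (suc v) k l G _ k≥1 edgeRegular@(regular , _) _ =
  2k≤v+λ G edgeRegular xy , mk⇔ equality⇒multipartite multipartite⇒equality
  where
  edgeAtZero : ∃ λ y → adj G zero y ≡ true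
  edgeAtZero = count≥1⇒∃ (adj G zero) (subst (_≥ 1) (sym (regular zero)) k≥1)

  y : Fin (suc v)
  y = proj₁ edgeAtZero

  xy : adj G zero y ≡ true
  xy = proj₂ edgeAtZero

  equality⇒multipartite : suc v + l ≡ 2 * k → CompleteMultipartite G
  equality⇒multipartite eq = nonAdjacencyTransitive⇒completeMultipartite G
    (edgesDominate⇒nonAdjacencyTransitive G
      (λ _ _ e → Equivalence.to (v+λ≡2k⇔dominates G edgeRegular e) eq))

  multipartite⇒equality : CompleteMultipartite G → suc v + l ≡ 2 * k
  multipartite⇒equality cm = Equivalence.from (v+λ≡2k⇔dominates G edgeRegular xy)
    (completeMultipartite⇒edgesDominate G cm zero y xy)
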